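{- Let $(s_n)_{n\ge0}$ be Stewart's choral sequence, defined by $s_{3n}=0$, $s_{3n+1}=s_n$ for all $n\ge0$ and $s_{3n-1}=1$ for all $n\ge1$, and let $\mathrm{sum}_{\mathrm{sc}}(n)=\sum_{i=0}^{n}s_i$. Then for every integer $r\ge0$, $$\mathrm{sum}_{\mathrm{sc}}\!\left(\frac{3^r-1}{2}\right)=\frac{3^r-2r-1}{4}.$$ -}

module Defs where

open import Data.Nat using (ℕ; zero; suc; _+_; _*_)

-- Stewart's choral sequence, with recursion on a fuel argument.
-- sc-aux f n = s_n whenever n ≤ f (fuel f suffices since n/3 < n for n ≥ 1).
-- Cases by the residue of n mod 3, via the decomposition n = 3q + i:
--   s_{3q}   = 0
--   s_{3q+1} = s_q
--   s_{3q+2} = 1   (i.e. s_{3m-1} = 1 for m = q+1 ≥ 1)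
sc-aux : ℕ → ℕ → ℕ
sc-aux-step : ℕ → ℕ → ℕ → ℕ
sc-aux zero n = 0
sc-aux (suc f) n = sc-aux-step f 0 n

-- sc-aux-step f q k computes s_{3q + k} by reducing k modulo 3
sc-aux-step f q 0 = 0
sc-aux-step f q 1 = sc-aux f q
sc-aux-step f q 2 = 1
sc-aux-step f q (suc (suc (suc k))) = sc-aux-step f (suc q) k

s : ℕ → ℕ
s n = sc-aux n n

sumSc : ℕ → ℕ
sumSc zero = s 0
sumSc (suc n) = sumSc n + s (suc n)

-- Unfolding the fuelled definition gives the defining equations s(3q) = 0, s(3q+1) = s(q),
-- s(3q+2) = 1.  Grouping the indices 0,…,3m+1 into blocks {3k+2, 3k+3, 3k+4} then gives
-- sum_sc(3m+1) = sum_sc(m) + m.  The index (3^r - 1)/2 is the base-3 repunit R_r, and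
-- R_{r+1} = 3 R_r + 1, so the identity follows by induction on r using 2 R_r + 1 = 3^r.
module Submission where

open import Defs
open import Data.Nat using (ℕ; zero; suc; _+_; _*_; _∸_; _^_; _/_; _≤_; z≤n; s≤s⁻¹)
open import Data.Nat.Properties using (≤-refl; ≤-trans; m≤m*n; m≤n⇒m≤1+n; n≤1+n; +-comm; +-suc; +-identityʳ; m+n∸n≡m)
open import Data.Nat.DivMod using (m*n/n≡m)
open import Data.Nat.Tactic.RingSolver using (solve-∀)
open import Relation.Binary.PropositionalEquality using (_≡_; refl; sym; trans; cong; cong₂; module ≡-Reasoning)
open ≡-Reasoning

data Mod3 : ℕ → Set where
  [3*_]   : ∀ q → Mod3 (q * 3)
  [1+3*_] : ∀ q → Mod3 (1 + q * 3)
  [2+3*_] : ∀ q → Mod3 (2 + q * 3)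

mod3 : ∀ n → Mod3 n
mod3 zero = [3* 0 ]
mod3 (suc zero) = [1+3* 0 ]
mod3 (suc (suc zero)) = [2+3* 0 ]
mod3 (suc (suc (suc n))) with mod3 n
... | [3* q ]   = [3* suc q ]
... | [1+3* q ] = [1+3* suc q ]
... | [2+3* q ] = [2+3* suc q ]

sc-aux-step-shift : ∀ f p q k → sc-aux-step f p (q * 3 + k) ≡ sc-aux-step f (q + p) k
sc-aux-step-shift f p zero    k = refl
sc-aux-step-shift f p (suc q) k = trans (sc-aux-step-shift f (suc p) q k) (cong (λ p′ → sc-aux-step f p′ k) (+-suc q p))

sc-aux-suc : ∀ f q k → sc-aux (suc f) (k + q * 3) ≡ sc-aux-step f q k
sc-aux-suc f q k = begin
  sc-aux-step f 0 (k + q * 3)  ≡⟨ cong (sc-aux-step f 0) (+-comm k (q * 3)) ⟩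
  sc-aux-step f 0 (q * 3 + k)  ≡⟨ sc-aux-step-shift f 0 q k ⟩
  sc-aux-step f (q + 0) k      ≡⟨ cong (λ p → sc-aux-step f p k) (+-identityʳ q) ⟩
  sc-aux-step f q k            ∎

1+3*q≤1+f⇒q≤f : ∀ {q f} → 1 + q * 3 ≤ suc f → q ≤ f
1+3*q≤1+f⇒q≤f {q} le = ≤-trans (m≤m*n q 3) (s≤s⁻¹ le)

sc-aux-fuel : ∀ {f g n} → n ≤ f → n ≤ g → sc-aux f n ≡ sc-aux g n
sc-aux-fuel {zero}  {zero}  z≤n z≤n = refl
sc-aux-fuel {zero}  {suc g} z≤n _   = refl
sc-aux-fuel {suc f} {zero}  _   z≤n = refl
sc-aux-fuel {suc f} {suc g} {n} n≤1+f n≤1+g with mod3 n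
... | [3* q ]   = trans (sc-aux-suc f q 0) (sym (sc-aux-suc g q 0))
... | [1+3* q ] = begin
  sc-aux (suc f) (1 + q * 3)  ≡⟨ sc-aux-suc f q 1 ⟩
  sc-aux f q                  ≡⟨ sc-aux-fuel (1+3*q≤1+f⇒q≤f n≤1+f) (1+3*q≤1+f⇒q≤f n≤1+g) ⟩
  sc-aux g q                  ≡⟨ sym (sc-aux-suc g q 1) ⟩
  sc-aux (suc g) (1 + q * 3)  ∎
... | [2+3* q ] = trans (sc-aux-suc f q 2) (sym (sc-aux-suc g q 2))

s≡sc-aux-suc : ∀ n → s n ≡ sc-aux (suc n) n
s≡sc-aux-suc n = sc-aux-fuel ≤-refl (n≤1+n n)

s-3* : ∀ q → s (q * 3) ≡ 0
s-3* q = trans (s≡sc-aux-suc (q * 3)) (sc-aux-suc (q * 3) q 0)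

s-1+3* : ∀ q → s (1 + q * 3) ≡ s q
s-1+3* q = begin
  s (1 + q * 3)                         ≡⟨ s≡sc-aux-suc (1 + q * 3) ⟩
  sc-aux (suc (1 + q * 3)) (1 + q * 3)  ≡⟨ sc-aux-suc (1 + q * 3) q 1 ⟩
  sc-aux (1 + q * 3) q                  ≡⟨ sc-aux-fuel (m≤n⇒m≤1+n (m≤m*n q 3)) ≤-refl ⟩
  s q                                   ∎

s-2+3* : ∀ q → s (2 + q * 3) ≡ 1
s-2+3* q = trans (s≡sc-aux-suc (2 + q * 3)) (sc-aux-suc (2 + q * 3) q 2)

sumSc-1+3* : ∀ m → sumSc (1 + m * 3) ≡ sumSc m + m
sumSc-1+3* zero    = refl
sumSc-1+3* (suc m) = begin
  sumSc (1 + suc m * 3)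
    ≡⟨⟩
  sumSc (1 + m * 3) + s (2 + m * 3) + s (suc m * 3) + s (1 + suc m * 3)
    ≡⟨ cong₂ _+_ (cong₂ _+_ (cong₂ _+_ (sumSc-1+3* m) (s-2+3* m)) (s-3* (suc m))) (s-1+3* (suc m)) ⟩
  sumSc m + m + 1 + 0 + s (suc m)
    ≡⟨ rearrange (sumSc m) m (s (suc m)) ⟩
  sumSc m + s (suc m) + suc m
    ∎
  where
  rearrange : ∀ a m b → a + m + 1 + 0 + b ≡ a + b + suc m
  rearrange = solve-∀

repunit : ℕ → ℕ → ℕ
repunit b zero    = 0
repunit b (suc r) = 1 + repunit b r * b

repunit-closed : ∀ c r → repunit (suc c) r * c + 1 ≡ suc c ^ r
repunit-closed c zero    = refl
repunit-closed c (suc r) = begin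
  (1 + R * suc c) * c + 1  ≡⟨ factor R c ⟩
  suc c * (R * c + 1)      ≡⟨ cong (suc c *_) (repunit-closed c r) ⟩
  suc c * suc c ^ r        ∎
  where
  R = repunit (suc c) r
  factor : ∀ R c → (1 + R * suc c) * c + 1 ≡ suc c * (R * c + 1)
  factor = solve-∀

repunit-div : ∀ d r → (suc (suc d) ^ r ∸ 1) / suc d ≡ repunit (suc (suc d)) r
repunit-div d r = begin
  (suc (suc d) ^ r ∸ 1) / suc d  ≡⟨ cong (λ x → (x ∸ 1) / suc d) (sym (repunit-closed (suc d) r)) ⟩
  (R * suc d + 1 ∸ 1) / suc d    ≡⟨ cong (_/ suc d) (m+n∸n≡m (R * suc d) 1) ⟩
  R * suc d / suc d              ≡⟨ m*n/n≡m R (suc d) ⟩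
  R                              ∎
  where
  R = repunit (suc (suc d)) r

sumSc-repunit₃ : ∀ r → 4 * sumSc (repunit 3 r) + 2 * r + 1 ≡ 3 ^ r
sumSc-repunit₃ zero    = refl
sumSc-repunit₃ (suc r) = begin
  4 * sumSc (1 + R * 3) + 2 * suc r + 1             ≡⟨ cong (λ x → 4 * x + 2 * suc r + 1) (sumSc-1+3* R) ⟩
  4 * (sumSc R + R) + 2 * suc r + 1                 ≡⟨ regroup (sumSc R) R r ⟩
  (4 * sumSc R + 2 * r + 1) + 2 * (R * 2 + 1)       ≡⟨ cong₂ (λ x y → x + 2 * y) (sumSc-repunit₃ r) (repunit-closed 2 r) ⟩
  3 ^ r + 2 * 3 ^ r                                 ≡⟨ triple (3 ^ r) ⟩
  3 * 3 ^ r                                         ∎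
  where
  R = repunit 3 r
  regroup : ∀ a R r → 4 * (a + R) + 2 * suc r + 1 ≡ (4 * a + 2 * r + 1) + 2 * (R * 2 + 1)
  regroup = solve-∀
  triple : ∀ x → x + 2 * x ≡ 3 * x
  triple = solve-∀

mainTheorem17 : (r : ℕ) → 4 * sumSc ((3 ^ r ∸ 1) / 2) + 2 * r + 1 ≡ 3 ^ r
mainTheorem17 r = begin
  4 * sumSc ((3 ^ r ∸ 1) / 2) + 2 * r + 1  ≡⟨ cong (λ n → 4 * sumSc n + 2 * r + 1) (repunit-div 1 r) ⟩
  4 * sumSc (repunit 3 r) + 2 * r + 1      ≡⟨ sumSc-repunit₃ r ⟩
  3 ^ r                                    ∎
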